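{- If $\Phi\to\Psi$ is a shallow natural step, i.e. an instance of one of the natural rules poll↓, poll↑, epis, epet, srep, ipis, ipet exactly as stated (not further placed inside an enclosing context), then $\Phi\equiv\Psi$.
   Context: Fix a countable set $\mathcal{V}$ of variables and a first-order signature: a countable set $\mathcal{P}$ of predicate symbols with arities $\mathrm{ar}:\mathcal{P}\to\mathbb{N}$. Flowers and gardens by mutual induction: atoms $p(\vec x)$ ($\vec x\in\mathcal V^{\mathrm{ar}(p)}$) are flowers; if $\mathbf{x}\subset\mathcal{V}$ is finite (a sprinkler) and $\Phi$ a finite multiset of flowers (a bouquet), $\mathbf{x}\cdot\Phi$ is a garden; if $\gamma$ is a garden (pistil) and $\Delta$ a finite multiset of gardens (petals), $\gamma\rhd\Delta$ is a flower, also written $\gamma\rhd\delta_1;\dots;\delta_n$. $\emptyset\cdot\Phi$ is written $\Phi$; $\emptyset$ is the empty bouquet; comma is multiset union; $\mathbf x,\mathbf y$ denotes $\mathbf x\cup\mathbf y$. Free variables: $\mathrm{fv}(p(\vec x))$ = variables of $\vec x$; $\mathrm{fv}(\Phi)=\bigcup\mathrm{fv}(\phi)$; $\mathrm{fv}(\mathbf{x}\cdot\Phi)=\mathrm{fv}(\Phi)\setminus\mathbf{x}$; $\mathrm{fv}(\mathbf{x}\cdot\Phi\rhd\Delta)=\mathrm{fv}(\mathbf{x}\cdot\Phi)\cup\bigcup_{\mathbf{y}\cdot\Psi\in\Delta}\mathrm{fv}((\mathbf{x}\cup\mathbf{y})\cdot\Psi)$. Bound variables: $\mathrm{bv}(p(\vec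 x))=\emptyset$, $\mathrm{bv}(\Phi)=\bigcup\mathrm{bv}(\phi)$, $\mathrm{bv}(\mathbf x\cdot\Phi)=\mathbf x\cup\mathrm{bv}(\Phi)$, $\mathrm{bv}(\gamma\rhd\Delta)=\mathrm{bv}(\gamma)\cup\bigcup_{\delta\in\Delta}\mathrm{bv}(\delta)$. Standing convention: every bouquet considered has pairwise distinct binders and $\mathrm{bv}(\Phi)\cap\mathrm{fv}(\Phi)=\emptyset$. Substitutions: $f[R\mapsto g]$ equals $g$ on $R$ and $f$ elsewhere. A substitution is $\sigma:\mathcal V\to\mathcal V$ with finite support; $\sigma:\mathbf y$ means support $\mathbf y$; $\sigma_{ -\mathbf x}:=\sigma[\mathbf x\mapsto\mathrm{id}]$. Action: $\sigma(p(x_1,\dots,x_n))=p(\sigma(x_1),\dots,\sigma(x_n))$, elementwise on bouquets, $\sigma(\mathbf x\cdot\Phi)=\mathbf x\cdot\sigma_{ -\mathbf x}(\Phi)$, $\sigma(\mathbf x\cdot\Phi\rhd\delta_1;\dots;\delta_n)=\sigma(\mathbf x\cdot\Phi)\rhd\sigma_{ -\mathbf x}(\delta_1);\dots;\sigma_{ -\mathbf x}(\delta_n)$. $\sigma:\mathbf y$ is capture-avoiding in $\Phi$ if $\sigma(\mathbf y)\cap\mathrm{bv}(\Phi)=\emptyset$. Contexts: $\Xi::=\Psi,\xi$, $\xi::=\Box\mid(\mathbf x\cdot\Xi\rhd\Delta)\mid(\gamma\rhd\mathbf x\cdot\Xi;\Delta)$; $\Xi\{\Psi\}$ fills the hole with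 bouquet $\Psi$, $\Xi\{\}$ with $\emptyset$. A flower $\phi$ can be pollinated in $\Xi$ if there are a bouquet $\Psi\ni\phi$ and contexts $\Xi',\Xi_0$ with $\Xi=\Xi'\{\Psi,\Xi_0\}$ or $\Xi=\Xi'\{\mathbf x\cdot\Psi\rhd\mathbf y\cdot\Xi_0;\Delta\}$; a bouquet can be pollinated if each flower can. Natural rules (conclusion $\to$ premiss): (poll↓) $\Xi\{\Phi\}\to\Xi\{\}$, (poll↑) $\Xi\{\}\to\Xi\{\Phi\}$ for any context $\Xi$ in which $\Phi$ can be pollinated; (epis) $\Phi\to(\emptyset\cdot\emptyset\rhd\emptyset\cdot\Phi)$; (epet) $(\gamma\rhd\emptyset\cdot\emptyset;\Delta)\to\emptyset$; (srep) $(\mathbf x\cdot(\Phi,(\emptyset\cdot\emptyset\rhd\gamma_1;\dots;\gamma_n))\rhd\Delta)\to(\mathbf x\cdot\Phi\rhd\emptyset\cdot\{(\gamma_1\rhd\Delta),\dots,(\gamma_n\rhd\Delta)\})$; (ipis) $(\mathbf x,\mathbf y\cdot\Phi\rhd\Delta)\to(\mathbf x\cdot\sigma(\Phi)\rhd\sigma(\Delta)),(\mathbf x,\mathbf y\cdot\Phi\rhd\Delta)$ with $\sigma:\mathbf y$ capture-avoiding in $(\emptyset\cdot\Phi\rhd\Delta)$; (ipet) $(\gamma\rhd\mathbf x,\mathbf y\cdot\Phi;\Delta)\to(\gamma\rhd\mathbf x\cdot\sigma(\Phi);\mathbf x,\mathbf y\cdot\Phi;\Delta)$ with $\sigma:\mathbf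 y$ capture-avoiding in $\Phi$. Semantics: a Kripke structure $(W,\le,(M_w)_{w\in W})$ has a preorder $\le$ on worlds and for each $w$ a nonempty domain $M_w$ and relations $[\![p]\!]_w\subseteq M_w^{\mathrm{ar}(p)}$, with $M_w\subseteq M_{w'}$ and $[\![p]\!]_w\subseteq[\![p]\!]_{w'}$ when $w\le w'$. A $w$-evaluation is $e:\mathcal V\to M_w$. Forcing: $w\Vdash_e p(x_1,\dots,x_n)$ iff $(e(x_1),\dots,e(x_n))\in[\![p]\!]_w$; $w\Vdash_e\Phi$ iff $w\Vdash_e\phi$ for all $\phi\in\Phi$; $w\Vdash_e(\mathbf x\cdot\Phi\rhd\mathbf x_1\cdot\Phi_1;\dots;\mathbf x_n\cdot\Phi_n)$ iff for every $w'\ge w$ and $w'$-evaluation $e'$ with $w'\Vdash_{e[\mathbf x\mapsto e']}\Phi$, there are $i$ and a $w'$-evaluation $e''$ with $w'\Vdash_{e[\mathbf x\mapsto e'][\mathbf x_i\mapsto e'']}\Phi_i$. $\Phi\models\Psi$ means that in every Kripke structure, at every world $w$ and $w$-evaluation $e$, $w\Vdash_e\Phi$ implies $w\Vdash_e\Psi$; $\Phi\equiv\Psi$ means $\Phi\models\Psi$ and $\Psi\models\Phi$. -}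

module Defs where

open import Level using (Level; Setω) renaming (suc to lsuc; zero to lzero)
open import Data.Nat using (ℕ; _≟_)
open import Data.Bool using (if_then_else_)
open import Data.List using (List; []; _∷_; _++_; [_]; concat; filter; map)
open import Data.List.Membership.Propositional using (_∈_; _∉_)
open import Data.List.Membership.DecPropositional _≟_ using (_∈?_)
open import Data.List.Relation.Unary.All using (All)
open import Data.Vec as Vec using (Vec; toList)
import Data.Vec.Relation.Unary.All as VecAll
open import Data.Product using (Σ; _×_; _,_)
open import Data.Sum using (_⊎_)
open import Data.Unit.Polymorphic using (⊤)
open import Data.Empty.Polymorphic using (⊥)
open import Data.Empty using () renaming (⊥ to ⊥₀)
open import Relation.Nullary using (¬_; ¬?; does)
open import Relation.Binary.PropositionalEquality using (_≡_; _≢_)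
open import Function.Definitions using (Injective)

-- Sprinklers (finite subsets of 𝒱)
-- are lists of variables (read as the set of their elements); the union
-- 𝐱,𝐲 is list concatenation.  Bouquets / sets of petals (finite
-- multisets) are lists.

Var : Set
Var = ℕ

Sprinkler : Set
Sprinkler = List Var

Disjoint : List Var → List Var → Set
Disjoint xs ys = ∀ v → v ∈ xs → v ∈ ys → ⊥₀

-- A countable first-order signature (predicate symbols with arities);
-- countability is witnessed by an injection into ℕ.
record Signature : Set₁ where
  field
    Pred     : Set
    ar       : Pred → ℕ
    code     : Pred → ℕ
    code-inj : Injective _≡_ _≡_ code

module Syntax (S : Signature) where
  open Signature S

  infix 6 _·_
  infix 5 _▷_
  mutual
    data Flower : Set where
      atom : (p : Pred) → Vec Var (ar p) → Flower
      _▷_  : Garden → List Garden → Flower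

    data Garden : Set where
      _·_ : Sprinkler → List Flower → Garden

  Bouquet : Set
  Bouquet = List Flower

  mutual
    fvF : Flower → List Var
    fvF (atom p xs) = toList xs
    fvF ((x · Φ) ▷ Δ) = fvBinder x Φ ++ fvPetals x Δ

    fvB : Bouquet → List Var
    fvB [] = []
    fvB (φ ∷ Φ) = fvF φ ++ fvB Φ

    fvBinder : Sprinkler → Bouquet → List Var
    fvBinder x Φ = filter (λ v → ¬? (v ∈? x)) (fvB Φ)

    fvPetals : Sprinkler → List Garden → List Var
    fvPetals x [] = []
    fvPetals x ((y · Ψ) ∷ Δ) = fvBinder (x ++ y) Ψ ++ fvPetals x Δ

  mutual
    bvF : Flower → List Var
    bvF (atom p xs) = []
    bvF (γ ▷ Δ) = bvG γ ++ bvGs Δ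

    bvB : Bouquet → List Var
    bvB [] = []
    bvB (φ ∷ Φ) = bvF φ ++ bvB Φ

    bvG : Garden → List Var
    bvG (x · Φ) = x ++ bvB Φ

    bvGs : List Garden → List Var
    bvGs [] = []
    bvGs (δ ∷ Δ) = bvG δ ++ bvGs Δ

  Subst : Set
  Subst = Var → Var

  _[_↦_] : ∀ {a} {A : Set a} → (Var → A) → Sprinkler → (Var → A) → Var → A
  (f [ R ↦ g ]) v = if does (v ∈? R) then g v else f v

  _₋_ : Subst → Sprinkler → Subst
  σ ₋ x = σ [ x ↦ (λ v → v) ]

  HasSupport : Subst → Sprinkler → Set
  HasSupport σ y = (∀ v → v ∈ y → σ v ≢ v) × (∀ v → v ∉ y → σ v ≡ v)

  mutual
    subF : Subst → Flower → Flower
    subF σ (atom p xs) = atom p (Vec.map σ xs)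
    subF σ ((x · Φ) ▷ Δ) = subG σ (x · Φ) ▷ subGs (σ ₋ x) Δ

    subB : Subst → Bouquet → Bouquet
    subB σ [] = []
    subB σ (φ ∷ Φ) = subF σ φ ∷ subB σ Φ

    subG : Subst → Garden → Garden
    subG σ (x · Φ) = x · subB (σ ₋ x) Φ

    subGs : Subst → List Garden → List Garden
    subGs σ [] = []
    subGs σ (δ ∷ Δ) = subG σ δ ∷ subGs σ Δ

  CaptureAvoiding : Subst → Sprinkler → Bouquet → Set
  CaptureAvoiding σ y Φ = ∀ v → v ∈ y → σ v ∉ bvB Φ

  -- Contexts  Ξ ::= Ψ, ξ    ξ ::= □ | (𝐱·Ξ ▷ Δ) | (γ ▷ 𝐱·Ξ ; Δ)
  mutual
    data Ctx : Set where
      ctx : Bouquet → Hole → Ctx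

    data Hole : Set where
      □    : Hole
      pisH : Sprinkler → Ctx → List Garden → Hole
      petH : Garden → Sprinkler → Ctx → List Garden → Hole

  _⟪_⟫ : Ctx → Bouquet → Bouquet
  ctx Φ □ ⟪ Ψ ⟫ = Φ ++ Ψ
  ctx Φ (pisH x Ξ Δ) ⟪ Ψ ⟫ = Φ ++ [ (x · (Ξ ⟪ Ψ ⟫)) ▷ Δ ]
  ctx Φ (petH γ x Ξ Δ) ⟪ Ψ ⟫ = Φ ++ [ γ ▷ ((x · (Ξ ⟪ Ψ ⟫)) ∷ Δ) ]

  _⊚_ : Ctx → Ctx → Ctx
  ctx Φ □ ⊚ ctx Ψ ξ = ctx (Φ ++ Ψ) ξ
  ctx Φ (pisH x Ξ Δ) ⊚ Ξ₀ = ctx Φ (pisH x (Ξ ⊚ Ξ₀) Δ)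
  ctx Φ (petH γ x Ξ Δ) ⊚ Ξ₀ = ctx Φ (petH γ x (Ξ ⊚ Ξ₀) Δ)

  _,ᶜ_ : Bouquet → Ctx → Ctx
  Ψ ,ᶜ ctx Φ ξ = ctx (Ψ ++ Φ) ξ

  PollinatableF : Flower → Ctx → Set
  PollinatableF φ Ξ =
    Σ Bouquet λ Ψ → φ ∈ Ψ × Σ Ctx λ Ξ' → Σ Ctx λ Ξ₀ →
      (Ξ ≡ Ξ' ⊚ (Ψ ,ᶜ Ξ₀))
      ⊎ (Σ Sprinkler λ x → Σ Sprinkler λ y → Σ (List Garden) λ Δ →
           Ξ ≡ Ξ' ⊚ ctx [] (petH (x · Ψ) y Ξ₀ Δ))

  Pollinatable : Bouquet → Ctx → Set
  Pollinatable Φ Ξ = All (λ φ → PollinatableF φ Ξ) Φ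

  -- The natural rules, as shallow steps  conclusion → premiss
  data ShallowStep : Bouquet → Bouquet → Set where
    poll↓ : (Ξ : Ctx) (Φ : Bouquet) → Pollinatable Φ Ξ →
            ShallowStep (Ξ ⟪ Φ ⟫) (Ξ ⟪ [] ⟫)
    poll↑ : (Ξ : Ctx) (Φ : Bouquet) → Pollinatable Φ Ξ →
            ShallowStep (Ξ ⟪ [] ⟫) (Ξ ⟪ Φ ⟫)
    epis  : (Φ : Bouquet) →
            ShallowStep Φ [ ([] · []) ▷ [ [] · Φ ] ]
    epet  : (γ : Garden) (Δ : List Garden) →
            ShallowStep [ γ ▷ (([] · []) ∷ Δ) ] []
    srep  : (x : Sprinkler) (Φ : Bouquet) (γs Δ : List Garden) →
            ShallowStep [ (x · (Φ ++ [ ([] · []) ▷ γs ])) ▷ Δ ]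
                        [ (x · Φ) ▷ [ [] · map (λ γ → γ ▷ Δ) γs ] ]
    ipis  : (x y : Sprinkler) (Φ : Bouquet) (Δ : List Garden) (σ : Subst) →
            HasSupport σ y → CaptureAvoiding σ y [ ([] · Φ) ▷ Δ ] →
            ShallowStep [ ((x ++ y) · Φ) ▷ Δ ]
                        (((x · subB σ Φ) ▷ subGs σ Δ) ∷ [ ((x ++ y) · Φ) ▷ Δ ])
    ipet  : (γ : Garden) (x y : Sprinkler) (Φ : Bouquet) (Δ : List Garden)
            (σ : Subst) → HasSupport σ y → CaptureAvoiding σ y Φ →
            ShallowStep [ γ ▷ (((x ++ y) · Φ) ∷ Δ) ]
                        [ γ ▷ ((x · subB σ Φ) ∷ ((x ++ y) · Φ) ∷ Δ) ]

  -- Standing variable convention (imposed on the conclusion of a step):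
  -- bv ∩ fv = ∅, and no binder rebinds a variable already bound in an
  -- enclosing scope.
  mutual
    NoShadowF : List Var → Flower → Set
    NoShadowF S (atom p xs) = ⊤
    NoShadowF S ((x · Φ) ▷ Δ) =
      Disjoint x S × NoShadowB (S ++ x) Φ × NoShadowPetals (S ++ x) Δ

    NoShadowB : List Var → Bouquet → Set
    NoShadowB S [] = ⊤
    NoShadowB S (φ ∷ Φ) = NoShadowF S φ × NoShadowB S Φ

    NoShadowPetals : List Var → List Garden → Set
    NoShadowPetals S [] = ⊤
    NoShadowPetals S ((y · Ψ) ∷ Δ) =
      (Disjoint y S × NoShadowB (S ++ y) Ψ) × NoShadowPetals S Δ

  Convention : Bouquet → Set
  Convention Φ = NoShadowB [] Φ × Disjoint (bvB Φ) (fvB Φ)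

  record Kripke (ℓ : Level) : Set (lsuc ℓ) where
    field
      W        : Set ℓ
      _≤_      : W → W → Set ℓ
      ≤-refl   : ∀ {w} → w ≤ w
      ≤-trans  : ∀ {u v w} → u ≤ v → v ≤ w → u ≤ w
      -- domains M_w as subsets of a common carrier D
      D        : Set ℓ
      M        : W → D → Set ℓ
      M-ne     : ∀ w → Σ D (M w)
      M-mono   : ∀ {w w' d} → w ≤ w' → M w d → M w' d
      rel      : W → (p : Pred) → Vec D (ar p) → Set ℓ
      rel-M    : ∀ {w p ds} → rel w p ds → VecAll.All (M w) ds
      rel-mono : ∀ {w w' p ds} → w ≤ w' → rel w p ds → rel w' p ds

    Eval : W → (Var → D) → Set ℓ
    Eval w e = ∀ v → M w (e v)

    mutual
      ⊩F : W → (Var → D) → Flower → Set ℓ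
      ⊩F w e (atom p xs) = rel w p (Vec.map e xs)
      ⊩F w e ((x · Φ) ▷ Δ) =
        ∀ w' → w ≤ w' → (e' : Var → D) → Eval w' e' →
        ⊩B w' (e [ x ↦ e' ]) Φ → ⊩Petal w' (e [ x ↦ e' ]) Δ

      ⊩B : W → (Var → D) → Bouquet → Set ℓ
      ⊩B w e [] = ⊤
      ⊩B w e (φ ∷ Φ) = ⊩F w e φ × ⊩B w e Φ

      ⊩Petal : W → (Var → D) → List Garden → Set ℓ
      ⊩Petal w e [] = ⊥
      ⊩Petal w e ((y · Ψ) ∷ Δ) =
        (Σ (Var → D) λ e'' → Eval w e'' × ⊩B w (e [ y ↦ e'' ]) Ψ)
        ⊎ ⊩Petal w e Δ

  _⊨_ : Bouquet → Bouquet → Setω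
  Φ ⊨ Ψ = ∀ {ℓ} (K : Kripke ℓ) → let open Kripke K in
          ∀ (w : W) (e : Var → D) → Eval w e → ⊩B w e Φ → ⊩B w e Ψ

  record _≡ₛ_ (Φ Ψ : Bouquet) : Setω where
    field
      to   : Φ ⊨ Ψ
      from : Ψ ⊨ Φ

{-# OPTIONS --safe #-}
-- Besides persistence, the coincidence lemma (forcing depends only on free
-- variables) and the substitution lemma (forcing σ Φ at ρ is forcing Φ at ρ ∘ σ
-- when σ moves no variable into a binder), the key fact is that filling a context
-- is a congruence for forcing even relative to a hypothesis Γ forced outside,
-- provided no binder on the path to the hole captures a free variable of Γ.
-- A pollinated flower is such a hypothesis: it is forced wherever its bouquet or
-- pistil is, and the variable convention rules out capture on the way to the
-- hole, so it can be added or removed there freely.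
module Submission where

open import Defs
open import Data.Nat using (_≟_)
open import Data.List using (List; []; _∷_; _++_; [_]; map)
open import Data.List.Properties using (++-assoc; ++-identityʳ)
open import Data.List.Membership.Propositional using (_∈_; _∉_)
open import Data.List.Membership.Propositional.Properties using (∈-++⁺ˡ; ∈-++⁺ʳ; ∈-++⁻; ∈-filter⁺; ∈-map⁺)
open import Data.List.Membership.DecPropositional _≟_ using (_∈?_)
open import Data.List.Relation.Binary.Subset.Propositional using (_⊆_)
open import Data.List.Relation.Unary.Any using (here; there)
open import Data.List.Relation.Unary.All using ([]; _∷_)
open import Data.Vec as Vec using (Vec; toList)
open import Data.Vec.Properties using (map-∘)
open import Data.Product using (Σ; ∃; _×_; _,_; proj₁; proj₂; map₁)
open import Data.Product.Function.NonDependent.Propositional using (_×-⇔_)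
open import Data.Sum using (_⊎_; inj₁; inj₂; [_,_]′; map₂)
open import Data.Sum.Function.Propositional using (_⊎-⇔_)
open import Data.Unit.Polymorphic using (tt)
open import Function using (_∘_; id; _⇔_; mk⇔; Equivalence)
open import Function.Properties.Equivalence using () renaming (refl to ⇔-refl; sym to ⇔-sym; trans to ⇔-trans)
open import Relation.Nullary using (yes; no; ¬?)
open import Relation.Nullary.Negation using (contradiction)
open import Relation.Binary.PropositionalEquality using (_≡_; refl; sym; trans; cong; cong₂; subst; _≗_; module ≡-Reasoning)

open Equivalence using (to; from)

module Binding (Sig : Signature) where
  open Syntax Sig

  module _ {a} {A : Set a} {f g : Var → A} (R : Sprinkler) where

    update-∈ : ∀ {v} → v ∈ R → (f [ R ↦ g ]) v ≡ g v
    update-∈ {v} v∈R with v ∈? R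
    ... | yes _ = refl
    ... | no v∉R = contradiction v∈R v∉R

    update-∉ : ∀ {v} → v ∉ R → (f [ R ↦ g ]) v ≡ f v
    update-∉ {v} v∉R with v ∈? R
    ... | yes v∈R = contradiction v∈R v∉R
    ... | no _ = refl

    update-≗ : (∀ {v} → v ∉ R → f v ≡ g v) → f [ R ↦ g ] ≗ g
    update-≗ agree v with v ∈? R
    ... | yes _ = refl
    ... | no v∉R = agree v∉R

  update-instance : ∀ {a} {A : Set a} {e g : Var → A} x {y} {σ : Subst} →
    (∀ {v} → v ∉ y → σ v ≡ v) → e [ x ++ y ↦ (e [ x ↦ g ]) ∘ σ ] ≗ (e [ x ↦ g ]) ∘ σ
  update-instance {e = e} {g} x {y} {σ} fixed = update-≗ (x ++ y) λ {v} v∉x++y → begin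
    e v                    ≡⟨ update-∉ {f = e} {g} x (v∉x++y ∘ ∈-++⁺ˡ) ⟨
    (e [ x ↦ g ]) v        ≡⟨ cong (e [ x ↦ g ]) (fixed (v∉x++y ∘ ∈-++⁺ʳ x)) ⟨
    (e [ x ↦ g ]) (σ v)    ∎
    where open ≡-Reasoning

  NoCaptureIn : Subst → List Var → Set
  NoCaptureIn σ V = ∀ v → σ v ≡ v ⊎ σ v ∉ V

  noCapture-⊆ : ∀ {σ V W} → W ⊆ V → NoCaptureIn σ V → NoCaptureIn σ W
  noCapture-⊆ W⊆V nc v = map₂ (_∘ W⊆V) (nc v)

  noCapture-₋ : ∀ {σ V} x → NoCaptureIn σ V → NoCaptureIn (σ ₋ x) V
  noCapture-₋ x nc v with v ∈? x
  ... | yes _ = inj₁ refl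
  ... | no _ = nc v

  captureAvoiding⇒noCapture : ∀ {σ y} Φ → HasSupport σ y → CaptureAvoiding σ y Φ → NoCaptureIn σ (bvB Φ)
  captureAvoiding⇒noCapture {y = y} Φ (_ , fixed) avoids v with v ∈? y
  ... | yes v∈y = inj₂ (avoids v v∈y)
  ... | no v∉y = inj₁ (fixed v v∉y)

  update-∘-₋ : ∀ {a} {A : Set a} {ρ g : Var → A} {σ} x → NoCaptureIn σ x →
    (ρ [ x ↦ g ]) ∘ (σ ₋ x) ≗ (ρ ∘ σ) [ x ↦ g ]
  update-∘-₋ {ρ = ρ} {g} {σ} x nc v with v ∈? x
  ... | yes v∈x = update-∈ {f = ρ} {g} x v∈x
  ... | no v∉x = update-∉ {f = ρ} {g} x ([ (λ σv≡v → subst (_∉ x) (sym σv≡v) v∉x) , id ]′ (nc v))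

  Disjoint-⊆ : ∀ {xs xs' ys ys'} → xs ⊆ xs' → ys ⊆ ys' → Disjoint xs' ys' → Disjoint xs ys
  Disjoint-⊆ xs⊆ ys⊆ d v p q = d v (xs⊆ p) (ys⊆ q)

  Disjoint-++ : ∀ {xs ys zs} → Disjoint xs zs → Disjoint ys zs → Disjoint (xs ++ ys) zs
  Disjoint-++ {xs} dxs dys v p = [ dxs v , dys v ]′ (∈-++⁻ xs p)

  fvBinder-∈ : ∀ {x Φ v} → v ∈ fvB Φ → v ∉ x → v ∈ fvBinder x Φ
  fvBinder-∈ {x} = ∈-filter⁺ (λ v → ¬? (v ∈? x))

  fvB-∈ : ∀ {φ Φ} → φ ∈ Φ → fvF φ ⊆ fvB Φ
  fvB-∈ (here refl) = ∈-++⁺ˡ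
  fvB-∈ {Φ = ψ ∷ _} (there φ∈) = ∈-++⁺ʳ (fvF ψ) ∘ fvB-∈ φ∈

  bvB-∈ : ∀ {φ Φ} → φ ∈ Φ → bvF φ ⊆ bvB Φ
  bvB-∈ (here refl) = ∈-++⁺ˡ
  bvB-∈ {Φ = ψ ∷ _} (there φ∈) = ∈-++⁺ʳ (bvF ψ) ∘ bvB-∈ φ∈

  fvB-++ʳ : ∀ Φ {Ψ} → fvB Ψ ⊆ fvB (Φ ++ Ψ)
  fvB-++ʳ [] = id
  fvB-++ʳ (φ ∷ Φ) = ∈-++⁺ʳ (fvF φ) ∘ fvB-++ʳ Φ

  bvB-++ʳ : ∀ Φ {Ψ} → bvB Ψ ⊆ bvB (Φ ++ Ψ)
  bvB-++ʳ [] = id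
  bvB-++ʳ (φ ∷ Φ) = ∈-++⁺ʳ (bvF φ) ∘ bvB-++ʳ Φ

  bvGs-∈ : ∀ {δ Δ} → δ ∈ Δ → bvG δ ⊆ bvGs Δ
  bvGs-∈ (here refl) = ∈-++⁺ˡ
  bvGs-∈ {Δ = δ ∷ _} (there δ∈) = ∈-++⁺ʳ (bvG δ) ∘ bvGs-∈ δ∈

  module _ (Φ : Bouquet) where

    fvB-pistil : ∀ {x Z Δ} → fvBinder x Z ⊆ fvB (Φ ++ [ (x · Z) ▷ Δ ])
    fvB-pistil = fvB-∈ (∈-++⁺ʳ Φ (here refl)) ∘ ∈-++⁺ˡ

    fvB-petal : ∀ {z Γ x Z Δ} → fvBinder (z ++ x) Z ⊆ fvB (Φ ++ [ (z · Γ) ▷ ((x · Z) ∷ Δ) ])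
    fvB-petal {z} {Γ} = fvB-∈ (∈-++⁺ʳ Φ (here refl)) ∘ ∈-++⁺ʳ (fvBinder z Γ) ∘ ∈-++⁺ˡ

    bvB-pistil : ∀ {γ Δ} → bvG γ ⊆ bvB (Φ ++ [ γ ▷ Δ ])
    bvB-pistil = bvB-∈ (∈-++⁺ʳ Φ (here refl)) ∘ ∈-++⁺ˡ

    bvB-petal : ∀ {γ δ Δ} → bvG δ ⊆ bvB (Φ ++ [ γ ▷ (δ ∷ Δ) ])
    bvB-petal {γ} = bvB-∈ (∈-++⁺ʳ Φ (here refl)) ∘ ∈-++⁺ʳ (bvG γ) ∘ ∈-++⁺ˡ

  noShadow-++ʳ : ∀ {S} Φ {Ψ} → NoShadowB S (Φ ++ Ψ) → NoShadowB S Ψ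
  noShadow-++ʳ [] = id
  noShadow-++ʳ (φ ∷ Φ) = noShadow-++ʳ Φ ∘ proj₂

  mutual
    bvF-fresh : ∀ {S} φ → NoShadowF S φ → Disjoint (bvF φ) S
    bvF-fresh (atom _ _) _ _ ()
    bvF-fresh ((x · Φ) ▷ Δ) (x#S , nsΦ , nsΔ) =
      Disjoint-++ (Disjoint-++ x#S (Disjoint-⊆ id ∈-++⁺ˡ (bvB-fresh Φ nsΦ)))
                  (Disjoint-⊆ id ∈-++⁺ˡ (bvGs-fresh Δ nsΔ))

    bvB-fresh : ∀ {S} Φ → NoShadowB S Φ → Disjoint (bvB Φ) S
    bvB-fresh [] _ _ ()
    bvB-fresh (φ ∷ Φ) (nsφ , nsΦ) = Disjoint-++ (bvF-fresh φ nsφ) (bvB-fresh Φ nsΦ)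

    bvGs-fresh : ∀ {S} Δ → NoShadowPetals S Δ → Disjoint (bvGs Δ) S
    bvGs-fresh [] _ _ ()
    bvGs-fresh ((y · Ψ) ∷ Δ) ((y#S , nsΨ) , nsΔ) =
      Disjoint-++ (Disjoint-++ y#S (Disjoint-⊆ id ∈-++⁺ˡ (bvB-fresh Ψ nsΨ))) (bvGs-fresh Δ nsΔ)

  fill-++ : ∀ Ψ Ξ {B} → (Ψ ,ᶜ Ξ) ⟪ B ⟫ ≡ Ψ ++ Ξ ⟪ B ⟫
  fill-++ Ψ (ctx Φ □) = ++-assoc Ψ Φ _
  fill-++ Ψ (ctx Φ (pisH _ _ _)) = ++-assoc Ψ Φ _
  fill-++ Ψ (ctx Φ (petH _ _ _ _)) = ++-assoc Ψ Φ _

  fill-⊚ : ∀ Ξ Ξ₀ {B} → (Ξ ⊚ Ξ₀) ⟪ B ⟫ ≡ Ξ ⟪ Ξ₀ ⟪ B ⟫ ⟫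
  fill-⊚ (ctx Φ □) (ctx Ψ ξ) = fill-++ Φ (ctx Ψ ξ)
  fill-⊚ (ctx Φ (pisH x Ξ Δ)) Ξ₀ = cong (λ Z → Φ ++ [ (x · Z) ▷ Δ ]) (fill-⊚ Ξ Ξ₀)
  fill-⊚ (ctx Φ (petH γ x Ξ Δ)) Ξ₀ = cong (λ Z → Φ ++ [ γ ▷ ((x · Z) ∷ Δ) ]) (fill-⊚ Ξ Ξ₀)

  fill-sibling : ∀ Ξ Ψ Ξ₀ {B} → (Ξ ⊚ (Ψ ,ᶜ Ξ₀)) ⟪ B ⟫ ≡ Ξ ⟪ Ψ ++ Ξ₀ ⟪ B ⟫ ⟫
  fill-sibling Ξ Ψ Ξ₀ = trans (fill-⊚ Ξ (Ψ ,ᶜ Ξ₀)) (cong (Ξ ⟪_⟫) (fill-++ Ψ Ξ₀))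

  -- Accumulated onto S in the order used by NoShadowB, so that noShadow-fill
  -- holds without reassociating.
  scope : List Var → Ctx → List Var
  scope S (ctx _ □) = S
  scope S (ctx _ (pisH x Ξ _)) = scope (S ++ x) Ξ
  scope S (ctx _ (petH (z · _) x Ξ _)) = scope ((S ++ z) ++ x) Ξ

  scope-⊇ : ∀ Ξ {S} → S ⊆ scope S Ξ
  scope-⊇ (ctx _ □) = id
  scope-⊇ (ctx _ (pisH x Ξ _)) = scope-⊇ Ξ ∘ ∈-++⁺ˡ
  scope-⊇ (ctx _ (petH (z · _) x Ξ _)) = scope-⊇ Ξ ∘ ∈-++⁺ˡ ∘ ∈-++⁺ˡ

  scope-bv : ∀ Ξ {S B v} → v ∈ scope S Ξ → v ∈ S ⊎ v ∈ bvB (Ξ ⟪ B ⟫)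
  scope-bv (ctx _ □) = inj₁
  scope-bv (ctx Φ (pisH x Ξ _)) {S} v∈ with scope-bv Ξ v∈
  ... | inj₂ v∈Ξ = inj₂ (bvB-pistil Φ (∈-++⁺ʳ x v∈Ξ))
  ... | inj₁ v∈S++x = map₂ (bvB-pistil Φ ∘ ∈-++⁺ˡ) (∈-++⁻ S v∈S++x)
  scope-bv (ctx Φ (petH (z · _) x Ξ _)) {S} v∈ with scope-bv Ξ v∈
  ... | inj₂ v∈Ξ = inj₂ (bvB-petal Φ (∈-++⁺ʳ x v∈Ξ))
  ... | inj₁ v∈S++z++x with ∈-++⁻ (S ++ z) v∈S++z++x
  ...   | inj₂ v∈x = inj₂ (bvB-petal Φ (∈-++⁺ˡ v∈x))
  ...   | inj₁ v∈S++z = map₂ (bvB-pistil Φ ∘ ∈-++⁺ˡ) (∈-++⁻ S v∈S++z)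

  bv-fill : ∀ Ξ {X} → bvB X ⊆ bvB (Ξ ⟪ X ⟫)
  bv-fill (ctx Φ □) = bvB-++ʳ Φ
  bv-fill (ctx Φ (pisH x Ξ _)) = bvB-pistil Φ ∘ ∈-++⁺ʳ x ∘ bv-fill Ξ
  bv-fill (ctx Φ (petH _ x Ξ _)) = bvB-petal Φ ∘ ∈-++⁺ʳ x ∘ bv-fill Ξ

  fv-fill : ∀ Ξ {S X v} → v ∈ fvB X → v ∉ scope S Ξ → v ∈ fvB (Ξ ⟪ X ⟫)
  fv-fill (ctx Φ □) v∈X _ = fvB-++ʳ Φ v∈X
  fv-fill (ctx Φ (pisH x Ξ _)) {S} {X} v∈X v∉ =
    fvB-pistil Φ (fvBinder-∈ {Φ = Ξ ⟪ X ⟫} (fv-fill Ξ v∈X v∉) (v∉ ∘ scope-⊇ Ξ ∘ ∈-++⁺ʳ S))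
  fv-fill (ctx Φ (petH (z · _) x Ξ _)) {S} {X} v∈X v∉ =
    fvB-petal Φ (fvBinder-∈ {Φ = Ξ ⟪ X ⟫} (fv-fill Ξ v∈X v∉)
      (v∉ ∘ scope-⊇ Ξ ∘ [ ∈-++⁺ˡ ∘ ∈-++⁺ʳ S , ∈-++⁺ʳ (S ++ z) ]′ ∘ ∈-++⁻ z))

  noShadow-fill : ∀ Ξ {S X} → NoShadowB S (Ξ ⟪ X ⟫) → NoShadowB (scope S Ξ) X
  noShadow-fill (ctx Φ □) ns = noShadow-++ʳ Φ ns
  noShadow-fill (ctx Φ (pisH _ Ξ _)) ns with noShadow-++ʳ Φ ns
  ... | (_ , nsΞ , _) , _ = noShadow-fill Ξ nsΞ
  noShadow-fill (ctx Φ (petH (_ · _) _ Ξ _)) ns with noShadow-++ʳ Φ ns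
  ... | (_ , _ , (_ , nsΞ) , _) , _ = noShadow-fill Ξ nsΞ

  -- A variable bound and free in X is either bound around the hole, and then
  -- rebound inside X, or free and bound in Ξ ⟪ X ⟫.
  convention-fill : ∀ Ξ {X} → Convention (Ξ ⟪ X ⟫) → NoShadowB (scope [] Ξ) X × Disjoint (bvB X) (fvB X)
  convention-fill Ξ {X} (ns , bv#fv) = nsX , bvX#fvX
    where
      nsX : NoShadowB (scope [] Ξ) X
      nsX = noShadow-fill Ξ ns
      bvX#fvX : Disjoint (bvB X) (fvB X)
      bvX#fvX v v∈bv v∈fv with v ∈? scope [] Ξ
      ... | yes v∈scope = bvB-fresh X nsX v v∈bv v∈scope
      ... | no v∉scope = bv#fv v (bv-fill Ξ v∈bv) (fv-fill Ξ v∈fv v∉scope)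

  sibling-fresh : ∀ Ξ Ψ Ξ₀ {φ B} → φ ∈ Ψ → Convention (Ξ ⟪ Ψ ++ Ξ₀ ⟪ B ⟫ ⟫) →
    Disjoint (scope [] Ξ₀) (fvF φ)
  sibling-fresh Ξ Ψ Ξ₀ φ∈ conv v v∈scope v∈φ with scope-bv Ξ₀ v∈scope
  ... | inj₂ v∈bv = proj₂ (convention-fill Ξ conv) v (bvB-++ʳ Ψ v∈bv) (fvB-∈ (∈-++⁺ˡ φ∈) v∈φ)

  pistil-fresh : ∀ Ξ x Ψ y Ξ₀ Δ {φ B} → φ ∈ Ψ →
    Convention (Ξ ⟪ [ (x · Ψ) ▷ ((y · Ξ₀ ⟪ B ⟫) ∷ Δ) ] ⟫) → Disjoint (scope y Ξ₀) (fvF φ)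
  pistil-fresh Ξ x Ψ y Ξ₀ Δ {φ} {B} φ∈ conv =
    Disjoint-⊆ ([ ∈-++⁺ˡ , ∈-++⁺ʳ y ]′ ∘ scope-bv Ξ₀) id petal#φ
    where
      -- a free variable of φ is either bound by x, which the petal may not rebind,
      -- or free in the whole flower
      petal#φ : Disjoint (bvG (y · Ξ₀ ⟪ B ⟫)) (fvF φ)
      petal#φ v v∈petal v∈φ with convention-fill Ξ conv | v ∈? x
      ... | ((_ , _ , nsΔ) , _) , _ | yes v∈x = bvGs-fresh _ nsΔ v (∈-++⁺ˡ v∈petal) (∈-++⁺ʳ _ v∈x)
      ... | _ , bv#fv | no v∉x =
        bv#fv v (bvB-petal [] {x · Ψ} {y · Ξ₀ ⟪ B ⟫} {Δ} v∈petal)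
                (fvB-pistil [] {x} {Ψ} {(y · Ξ₀ ⟪ B ⟫) ∷ Δ} (fvBinder-∈ {Φ = Ψ} (fvB-∈ φ∈ v∈φ) v∉x))

  pistil-bv-fresh : ∀ x Φ Δ → Convention [ (x · Φ) ▷ Δ ] → Disjoint (bvB Φ) (x ++ fvPetals x Δ)
  pistil-bv-fresh x Φ Δ (((_ , nsΦ , _) , _) , bv#fv) v v∈Φ v∈ =
    [ bvB-fresh Φ nsΦ v v∈Φ
    , bv#fv v (∈-++⁺ˡ (∈-++⁺ˡ (∈-++⁺ʳ x v∈Φ))) ∘ ∈-++⁺ˡ ∘ ∈-++⁺ʳ (fvBinder x Φ)
    ]′ (∈-++⁻ x v∈)

  srep-fresh : ∀ x Φ γs Δ {y Ψ} → Convention [ (x · (Φ ++ [ ([] · []) ▷ γs ])) ▷ Δ ] →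
    (y · Ψ) ∈ γs → Disjoint y (x ++ fvPetals x Δ)
  srep-fresh x Φ γs Δ conv γ∈ =
    Disjoint-⊆ (bvB-∈ (∈-++⁺ʳ Φ (here refl)) ∘ bvGs-∈ γ∈ ∘ ∈-++⁺ˡ) id (pistil-bv-fresh x _ Δ conv)

  fvPetals-head : ∀ x y Ψ Δ {v} → v ∉ y → v ∈ fvB Ψ → v ∈ x ++ fvPetals x ((y · Ψ) ∷ Δ)
  fvPetals-head x y Ψ Δ {v} v∉y v∈Ψ with v ∈? x
  ... | yes v∈x = ∈-++⁺ˡ v∈x
  ... | no v∉x = ∈-++⁺ʳ x (∈-++⁺ˡ (fvBinder-∈ {Φ = Ψ} v∈Ψ ([ v∉x , v∉y ]′ ∘ ∈-++⁻ x)))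

  fvPetals-tail : ∀ x δ Δ → x ++ fvPetals x Δ ⊆ x ++ fvPetals x (δ ∷ Δ)
  fvPetals-tail x (y · Ψ) Δ = [ ∈-++⁺ˡ , ∈-++⁺ʳ x ∘ ∈-++⁺ʳ (fvBinder (x ++ y) Ψ) ]′ ∘ ∈-++⁻ x

module Forcing (Sig : Signature) {ℓ} (K : Syntax.Kripke Sig ℓ) where
  open Syntax Sig
  open Binding Sig
  open Kripke K

  Env : Set ℓ
  Env = Var → D

  AgreeOn : List Var → Env → Env → Set ℓ
  AgreeOn V ρ₁ ρ₂ = ∀ {v} → v ∈ V → ρ₁ v ≡ ρ₂ v

  AgreeOn-update : ∀ {x V ρ₁ ρ₂ g} → (∀ {v} → v ∉ x → v ∈ V → ρ₁ v ≡ ρ₂ v) →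
    AgreeOn V (ρ₁ [ x ↦ g ]) (ρ₂ [ x ↦ g ])
  AgreeOn-update {x} agree {v} v∈V with v ∈? x
  ... | yes _ = refl
  ... | no v∉x = agree v∉x v∈V

  AgreeOn-fresh-update : ∀ {x V ρ g} → Disjoint x V → AgreeOn V ρ (ρ [ x ↦ g ])
  AgreeOn-fresh-update {x} x#V {v} v∈V with v ∈? x
  ... | yes v∈x = contradiction v∈V (x#V v v∈x)
  ... | no _ = refl

  Eval-mono : ∀ {w w' e} → w ≤ w' → Eval w e → Eval w' e
  Eval-mono w≤w' ev v = M-mono w≤w' (ev v)

  Eval-update : ∀ {w ρ g} x → Eval w ρ → Eval w g → Eval w (ρ [ x ↦ g ])
  Eval-update x evρ evg v with v ∈? x
  ... | yes _ = evg v
  ... | no _ = evρ v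

  ⊩F-mono : ∀ {w w' e} φ → w ≤ w' → ⊩F w e φ → ⊩F w' e φ
  ⊩F-mono (atom _ _) w≤w' = rel-mono w≤w'
  ⊩F-mono ((_ · _) ▷ _) w≤w' h w'' w'≤w'' = h w'' (≤-trans w≤w' w'≤w'')

  ⊩B-mono : ∀ {w w' e} Φ → w ≤ w' → ⊩B w e Φ → ⊩B w' e Φ
  ⊩B-mono [] _ _ = tt
  ⊩B-mono (φ ∷ Φ) w≤w' (hφ , hΦ) = ⊩F-mono φ w≤w' hφ , ⊩B-mono Φ w≤w' hΦ

  ⊩B-∈ : ∀ {w e φ Φ} → φ ∈ Φ → ⊩B w e Φ → ⊩F w e φ
  ⊩B-∈ (here refl) = proj₁
  ⊩B-∈ {Φ = _ ∷ _} (there φ∈) = ⊩B-∈ φ∈ ∘ proj₂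

  ⊩B-++⁺ : ∀ {w e} Φ {Ψ} → ⊩B w e Φ → ⊩B w e Ψ → ⊩B w e (Φ ++ Ψ)
  ⊩B-++⁺ [] _ hΨ = hΨ
  ⊩B-++⁺ (φ ∷ Φ) (hφ , hΦ) hΨ = hφ , ⊩B-++⁺ Φ hΦ hΨ

  ⊩B-++⁻ : ∀ {w e} Φ {Ψ} → ⊩B w e (Φ ++ Ψ) → ⊩B w e Φ × ⊩B w e Ψ
  ⊩B-++⁻ [] hΨ = tt , hΨ
  ⊩B-++⁻ (φ ∷ Φ) (hφ , hΦΨ) = map₁ (hφ ,_) (⊩B-++⁻ Φ hΦΨ)

  ⊩B-++-congʳ : ∀ {w e} Ψ {X Y} → (⊩B w e Ψ → ⊩B w e X ⇔ ⊩B w e Y) →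
    ⊩B w e (Ψ ++ X) ⇔ ⊩B w e (Ψ ++ Y)
  ⊩B-++-congʳ Ψ X⇔Y = mk⇔
    (λ h → let hΨ , hX = ⊩B-++⁻ Ψ h in ⊩B-++⁺ Ψ hΨ (to (X⇔Y hΨ) hX))
    (λ h → let hΨ , hY = ⊩B-++⁻ Ψ h in ⊩B-++⁺ Ψ hΨ (from (X⇔Y hΨ) hY))

  ⊩B-map⁺ : ∀ {w e} {f : Garden → Flower} γs → (∀ {γ} → γ ∈ γs → ⊩F w e (f γ)) → ⊩B w e (map f γs)
  ⊩B-map⁺ [] _ = tt
  ⊩B-map⁺ (γ ∷ γs) h = h (here refl) , ⊩B-map⁺ γs (h ∘ there)

  ⊩G : W → Env → Garden → Set ℓ
  ⊩G w ρ (y · Ψ) = Σ Env λ g → Eval w g × ⊩B w (ρ [ y ↦ g ]) Ψ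

  ⊩Petal-∈⁺ : ∀ {w ρ δ Δ} → δ ∈ Δ → ⊩G w ρ δ → ⊩Petal w ρ Δ
  ⊩Petal-∈⁺ {Δ = (_ · _) ∷ _} (here refl) = inj₁
  ⊩Petal-∈⁺ {Δ = (_ · _) ∷ _} (there δ∈) = inj₂ ∘ ⊩Petal-∈⁺ δ∈

  ⊩Petal-∈⁻ : ∀ {w ρ} Δ → ⊩Petal w ρ Δ → ∃ λ δ → δ ∈ Δ × ⊩G w ρ δ
  ⊩Petal-∈⁻ ((y · Ψ) ∷ Δ) (inj₁ h) = y · Ψ , here refl , h
  ⊩Petal-∈⁻ ((_ · _) ∷ Δ) (inj₂ h) = let δ , δ∈ , hδ = ⊩Petal-∈⁻ Δ h in δ , there δ∈ , hδ

  ∷-petal-cong : ∀ {w ρ₁ ρ₂} y {Ψ₁ Ψ₂ Δ₁ Δ₂} →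
    (∀ g → ⊩B w (ρ₁ [ y ↦ g ]) Ψ₁ ⇔ ⊩B w (ρ₂ [ y ↦ g ]) Ψ₂) →
    ⊩Petal w ρ₁ Δ₁ ⇔ ⊩Petal w ρ₂ Δ₂ →
    ⊩Petal w ρ₁ ((y · Ψ₁) ∷ Δ₁) ⇔ ⊩Petal w ρ₂ ((y · Ψ₂) ∷ Δ₂)
  ∷-petal-cong y Ψ⇔ Δ⇔ =
    mk⇔ (λ (g , evg , h) → g , evg , to (Ψ⇔ g) h) (λ (g , evg , h) → g , evg , from (Ψ⇔ g) h) ⊎-⇔ Δ⇔

  ▷-cong : ∀ {w ρ₁ ρ₂} x {Φ₁ Φ₂ Δ₁ Δ₂} →
    (∀ {w'} → w ≤ w' → ∀ g → ⊩B w' (ρ₁ [ x ↦ g ]) Φ₁ ⇔ ⊩B w' (ρ₂ [ x ↦ g ]) Φ₂) →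
    (∀ {w'} → w ≤ w' → ∀ g → ⊩B w' (ρ₁ [ x ↦ g ]) Φ₁ →
       ⊩Petal w' (ρ₁ [ x ↦ g ]) Δ₁ ⇔ ⊩Petal w' (ρ₂ [ x ↦ g ]) Δ₂) →
    ⊩F w ρ₁ ((x · Φ₁) ▷ Δ₁) ⇔ ⊩F w ρ₂ ((x · Φ₂) ▷ Δ₂)
  ▷-cong x pistil petals = mk⇔
    (λ h w' w≤w' g evg h₂ → let h₁ = from (pistil w≤w' g) h₂ in to (petals w≤w' g h₁) (h w' w≤w' g evg h₁))
    (λ h w' w≤w' g evg h₁ → from (petals w≤w' g h₁) (h w' w≤w' g evg (to (pistil w≤w' g) h₁)))

  Vec-map-agree : ∀ {ρ₁ ρ₂ n} (xs : Vec Var n) → AgreeOn (toList xs) ρ₁ ρ₂ →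
    Vec.map ρ₁ xs ≡ Vec.map ρ₂ xs
  Vec-map-agree Vec.[] _ = refl
  Vec-map-agree (x Vec.∷ xs) agree = cong₂ Vec._∷_ (agree (here refl)) (Vec-map-agree xs (agree ∘ there))

  mutual
    ⊩F-coincide : ∀ {w ρ₁ ρ₂} φ → AgreeOn (fvF φ) ρ₁ ρ₂ → ⊩F w ρ₁ φ ⇔ ⊩F w ρ₂ φ
    ⊩F-coincide {w} (atom p xs) agree = mk⇔ (subst (rel w p) eq) (subst (rel w p) (sym eq))
      where eq = Vec-map-agree xs agree
    ⊩F-coincide ((x · Φ) ▷ Δ) agree = ▷-cong x
      (λ _ g → ⊩B-coincide Φ (AgreeOn-update {g = g} λ v∉x v∈Φ →
         agree (∈-++⁺ˡ (fvBinder-∈ {Φ = Φ} v∈Φ v∉x))))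
      (λ _ g _ → ⊩Petal-coincide x Δ (AgreeOn-update {g = g} λ v∉x →
         agree ∘ ∈-++⁺ʳ (fvBinder x Φ) ∘ [ (λ v∈x → contradiction v∈x v∉x) , id ]′ ∘ ∈-++⁻ x))

    ⊩B-coincide : ∀ {w ρ₁ ρ₂} Φ → AgreeOn (fvB Φ) ρ₁ ρ₂ → ⊩B w ρ₁ Φ ⇔ ⊩B w ρ₂ Φ
    ⊩B-coincide [] _ = ⇔-refl
    ⊩B-coincide (φ ∷ Φ) agree =
      ⊩F-coincide φ (agree ∘ ∈-++⁺ˡ) ×-⇔ ⊩B-coincide Φ (agree ∘ ∈-++⁺ʳ (fvF φ))

    ⊩Petal-coincide : ∀ {w ρ₁ ρ₂} x Δ → AgreeOn (x ++ fvPetals x Δ) ρ₁ ρ₂ →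
      ⊩Petal w ρ₁ Δ ⇔ ⊩Petal w ρ₂ Δ
    ⊩Petal-coincide x [] _ = ⇔-refl
    ⊩Petal-coincide x ((y · Ψ) ∷ Δ) agree =
      ∷-petal-cong y (λ g → ⊩B-coincide Ψ (AgreeOn-update {g = g} λ v∉y → agree ∘ fvPetals-head x y Ψ Δ v∉y))
                     (⊩Petal-coincide x Δ (agree ∘ fvPetals-tail x (y · Ψ) Δ))

  ⊩B-≗ : ∀ {w ρ₁ ρ₂} Φ → ρ₁ ≗ ρ₂ → ⊩B w ρ₁ Φ ⇔ ⊩B w ρ₂ Φ
  ⊩B-≗ Φ ρ₁≗ρ₂ = ⊩B-coincide Φ (λ {v} _ → ρ₁≗ρ₂ v)

  ⊩Petal-≗ : ∀ {w ρ₁ ρ₂} Δ → ρ₁ ≗ ρ₂ → ⊩Petal w ρ₁ Δ ⇔ ⊩Petal w ρ₂ Δ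
  ⊩Petal-≗ Δ ρ₁≗ρ₂ = ⊩Petal-coincide [] Δ (λ {v} _ → ρ₁≗ρ₂ v)

  ⊩B-fresh-update : ∀ {w ρ g x} Γ → Disjoint x (fvB Γ) → ⊩B w ρ Γ → ⊩B w (ρ [ x ↦ g ]) Γ
  ⊩B-fresh-update {ρ = ρ} {g} Γ x#Γ = to (⊩B-coincide Γ (AgreeOn-fresh-update {ρ = ρ} {g} x#Γ))

  mutual
    ⊩F-sub : ∀ {w ρ σ} φ → NoCaptureIn σ (bvF φ) → ⊩F w ρ (subF σ φ) ⇔ ⊩F w (ρ ∘ σ) φ
    ⊩F-sub {w} {ρ} {σ} (atom p xs) _ = mk⇔ (subst (rel w p) (sym eq)) (subst (rel w p) eq)
      where eq = map-∘ ρ σ xs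
    ⊩F-sub {ρ = ρ} ((x · Φ) ▷ Δ) nc = ▷-cong x
      (λ _ g → ⇔-trans (⊩B-sub Φ (noCapture-₋ x (noCapture-⊆ (∈-++⁺ˡ ∘ ∈-++⁺ʳ x) nc)))
                       (⊩B-≗ Φ (update-∘-₋ {ρ = ρ} {g} x nc-x)))
      (λ _ g _ → ⇔-trans (⊩Petal-sub Δ (noCapture-₋ x (noCapture-⊆ (∈-++⁺ʳ (x ++ bvB Φ)) nc)))
                         (⊩Petal-≗ Δ (update-∘-₋ {ρ = ρ} {g} x nc-x)))
      where nc-x = noCapture-⊆ (∈-++⁺ˡ ∘ ∈-++⁺ˡ) nc

    ⊩B-sub : ∀ {w ρ σ} Φ → NoCaptureIn σ (bvB Φ) → ⊩B w ρ (subB σ Φ) ⇔ ⊩B w (ρ ∘ σ) Φ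
    ⊩B-sub [] _ = ⇔-refl
    ⊩B-sub (φ ∷ Φ) nc = ⊩F-sub φ (noCapture-⊆ ∈-++⁺ˡ nc) ×-⇔ ⊩B-sub Φ (noCapture-⊆ (∈-++⁺ʳ (bvF φ)) nc)

    ⊩Petal-sub : ∀ {w ρ σ} Δ → NoCaptureIn σ (bvGs Δ) → ⊩Petal w ρ (subGs σ Δ) ⇔ ⊩Petal w (ρ ∘ σ) Δ
    ⊩Petal-sub [] _ = ⇔-refl
    ⊩Petal-sub {ρ = ρ} ((y · Ψ) ∷ Δ) nc =
      ∷-petal-cong y (λ g → ⇔-trans (⊩B-sub Ψ (noCapture-₋ y (noCapture-⊆ (∈-++⁺ˡ ∘ ∈-++⁺ʳ y) nc)))
                                    (⊩B-≗ Ψ (update-∘-₋ {ρ = ρ} {g} y (noCapture-⊆ (∈-++⁺ˡ ∘ ∈-++⁺ˡ) nc))))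
                     (⊩Petal-sub Δ (noCapture-⊆ (∈-++⁺ʳ (y ++ bvB Ψ)) nc))

  ⊩B-instance : ∀ {w e g σ y} x Φ → HasSupport σ y → NoCaptureIn σ (bvB Φ) →
    ⊩B w (e [ x ↦ g ]) (subB σ Φ) ⇔ ⊩B w (e [ x ++ y ↦ (e [ x ↦ g ]) ∘ σ ]) Φ
  ⊩B-instance {e = e} {g} x Φ (_ , fixed) nc =
    ⇔-trans (⊩B-sub Φ nc) (⊩B-≗ Φ (sym ∘ update-instance {e = e} {g} x (fixed _)))

  ⊩Petal-instance : ∀ {w e g σ y} x Δ → HasSupport σ y → NoCaptureIn σ (bvGs Δ) →
    ⊩Petal w (e [ x ↦ g ]) (subGs σ Δ) ⇔ ⊩Petal w (e [ x ++ y ↦ (e [ x ↦ g ]) ∘ σ ]) Δ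
  ⊩Petal-instance {e = e} {g} x Δ (_ , fixed) nc =
    ⇔-trans (⊩Petal-sub Δ nc) (⊩Petal-≗ Δ (sym ∘ update-instance {e = e} {g} x (fixed _)))

  ⊩G-instance : ∀ {w ρ σ y} x Φ → HasSupport σ y → NoCaptureIn σ (bvB Φ) → Eval w ρ →
    ⊩G w ρ (x · subB σ Φ) → ⊩G w ρ ((x ++ y) · Φ)
  ⊩G-instance {σ = σ} x Φ supp nc evρ (g , evg , hσΦ) =
    _ , Eval-update x evρ evg ∘ σ , to (⊩B-instance x Φ supp nc) hσΦ

  ⊩-fill-cong : ∀ Ξ {S Γ X Y} → Disjoint (scope S Ξ) (fvB Γ) →
    (∀ {w e} → ⊩B w e Γ → ⊩B w e X ⇔ ⊩B w e Y) →
    ∀ {w e} → ⊩B w e Γ → ⊩B w e (Ξ ⟪ X ⟫) ⇔ ⊩B w e (Ξ ⟪ Y ⟫)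
  ⊩-fill-cong (ctx Φ □) _ X⇔Y hΓ = ⊩B-++-congʳ Φ λ _ → X⇔Y hΓ
  ⊩-fill-cong (ctx Φ (pisH x Ξ Δ)) {S} {Γ} {X} {Y} fresh X⇔Y {w} {e} hΓ =
    ⊩B-++-congʳ Φ λ _ → flower⇔ ×-⇔ ⇔-refl
    where
      x#Γ : Disjoint x (fvB Γ)
      x#Γ = Disjoint-⊆ (scope-⊇ Ξ ∘ ∈-++⁺ʳ S) id fresh
      flower⇔ : ⊩F w e ((x · Ξ ⟪ X ⟫) ▷ Δ) ⇔ ⊩F w e ((x · Ξ ⟪ Y ⟫) ▷ Δ)
      flower⇔ = ▷-cong x
        (λ w≤w' g → ⊩-fill-cong Ξ fresh X⇔Y (⊩B-fresh-update {g = g} Γ x#Γ (⊩B-mono Γ w≤w' hΓ)))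
        (λ _ _ _ → ⇔-refl)
  ⊩-fill-cong (ctx Φ (petH (z · Γ₀) x Ξ Δ)) {S} {Γ} {X} {Y} fresh X⇔Y {w} {e} hΓ =
    ⊩B-++-congʳ Φ λ _ → flower⇔ ×-⇔ ⇔-refl
    where
      z#Γ : Disjoint z (fvB Γ)
      z#Γ = Disjoint-⊆ (scope-⊇ Ξ ∘ ∈-++⁺ˡ ∘ ∈-++⁺ʳ S) id fresh
      x#Γ : Disjoint x (fvB Γ)
      x#Γ = Disjoint-⊆ (scope-⊇ Ξ ∘ ∈-++⁺ʳ (S ++ z)) id fresh
      flower⇔ : ⊩F w e ((z · Γ₀) ▷ ((x · Ξ ⟪ X ⟫) ∷ Δ)) ⇔ ⊩F w e ((z · Γ₀) ▷ ((x · Ξ ⟪ Y ⟫) ∷ Δ))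
      -- The petal lists must be given: ⊩F unfolds them, so they cannot be inferred.
      flower⇔ = ▷-cong z {Δ₁ = (x · Ξ ⟪ X ⟫) ∷ Δ} {(x · Ξ ⟪ Y ⟫) ∷ Δ} (λ _ _ → ⇔-refl) λ w≤w' g _ →
        ∷-petal-cong x (λ g' → ⊩-fill-cong Ξ fresh X⇔Y
          (⊩B-fresh-update {g = g'} Γ x#Γ (⊩B-fresh-update {g = g} Γ z#Γ (⊩B-mono Γ w≤w' hΓ))))
          ⇔-refl

  pollinate-fresh : ∀ Ξ {S φ B w e} → Disjoint (scope S Ξ) (fvF φ) → ⊩F w e φ →
    ⊩B w e (Ξ ⟪ φ ∷ B ⟫) ⇔ ⊩B w e (Ξ ⟪ B ⟫)
  pollinate-fresh Ξ {S} {φ} {B} fresh hφ =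
    ⊩-fill-cong Ξ {Γ = [ φ ]} (subst (Disjoint (scope S Ξ)) (sym (++-identityʳ (fvF φ))) fresh)
      (λ (hφ , _) → mk⇔ proj₂ (hφ ,_)) (hφ , tt)

  pollinate-sibling : ∀ Ξ Ψ Ξ₀ {φ B₀ B w e} → φ ∈ Ψ → Convention (Ξ ⟪ Ψ ++ Ξ₀ ⟪ B₀ ⟫ ⟫) →
    ⊩B w e (Ξ ⟪ Ψ ++ Ξ₀ ⟪ φ ∷ B ⟫ ⟫) ⇔ ⊩B w e (Ξ ⟪ Ψ ++ Ξ₀ ⟪ B ⟫ ⟫)
  pollinate-sibling Ξ Ψ Ξ₀ φ∈ conv = ⊩-fill-cong Ξ {S = []} {Γ = []} (λ _ _ ())
    (λ _ → ⊩B-++-congʳ Ψ λ hΨ → pollinate-fresh Ξ₀ (sibling-fresh Ξ Ψ Ξ₀ φ∈ conv) (⊩B-∈ φ∈ hΨ)) tt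

  pollinate-pistil : ∀ Ξ x Ψ y Ξ₀ Δ {φ B₀ B w e} → φ ∈ Ψ →
    Convention (Ξ ⟪ [ (x · Ψ) ▷ ((y · Ξ₀ ⟪ B₀ ⟫) ∷ Δ) ] ⟫) →
    ⊩B w e (Ξ ⟪ [ (x · Ψ) ▷ ((y · Ξ₀ ⟪ φ ∷ B ⟫) ∷ Δ) ] ⟫) ⇔
    ⊩B w e (Ξ ⟪ [ (x · Ψ) ▷ ((y · Ξ₀ ⟪ B ⟫) ∷ Δ) ] ⟫)
  pollinate-pistil Ξ x Ψ y Ξ₀ Δ {φ} {B = B} φ∈ conv =
    ⊩-fill-cong Ξ {S = []} {Γ = []} (λ _ _ ()) (λ _ → flower⇔ ×-⇔ ⇔-refl) tt
    where
      fresh : Disjoint (scope y Ξ₀) (fvF φ)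
      fresh = pistil-fresh Ξ x Ψ y Ξ₀ Δ φ∈ conv
      y#φ : Disjoint y (fvF φ)
      y#φ = Disjoint-⊆ (scope-⊇ Ξ₀) id fresh
      flower⇔ : ∀ {w e} →
        ⊩F w e ((x · Ψ) ▷ ((y · Ξ₀ ⟪ φ ∷ B ⟫) ∷ Δ)) ⇔ ⊩F w e ((x · Ψ) ▷ ((y · Ξ₀ ⟪ B ⟫) ∷ Δ))
      flower⇔ {e = e} =
        ▷-cong x {Δ₁ = (y · Ξ₀ ⟪ φ ∷ B ⟫) ∷ Δ} {(y · Ξ₀ ⟪ B ⟫) ∷ Δ} (λ _ _ → ⇔-refl) λ _ g hΨ →
        ∷-petal-cong y (λ g' → pollinate-fresh Ξ₀ fresh
          (to (⊩F-coincide φ (AgreeOn-fresh-update {ρ = e [ x ↦ g ]} {g'} y#φ)) (⊩B-∈ φ∈ hΨ)))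
          ⇔-refl

  pollinate : ∀ Ξ {φ B₀} → Convention (Ξ ⟪ B₀ ⟫) → PollinatableF φ Ξ →
    ∀ B {w e} → ⊩B w e (Ξ ⟪ φ ∷ B ⟫) ⇔ ⊩B w e (Ξ ⟪ B ⟫)
  pollinate _ {φ} conv (Ψ , φ∈ , Ξ , Ξ₀ , inj₁ refl) B
    rewrite fill-sibling Ξ Ψ Ξ₀ {φ ∷ B} | fill-sibling Ξ Ψ Ξ₀ {B} =
    pollinate-sibling Ξ Ψ Ξ₀ φ∈ (subst Convention (fill-sibling Ξ Ψ Ξ₀) conv)
  pollinate _ {φ} conv (Ψ , φ∈ , Ξ , Ξ₀ , inj₂ (x , y , Δ , refl)) B
    rewrite fill-⊚ Ξ (ctx [] (petH (x · Ψ) y Ξ₀ Δ)) {φ ∷ B} | fill-⊚ Ξ (ctx [] (petH (x · Ψ) y Ξ₀ Δ)) {B} =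
    pollinate-pistil Ξ x Ψ y Ξ₀ Δ φ∈ (subst Convention (fill-⊚ Ξ _) conv)

  pollinate-all : ∀ Ξ {Π B₀} → Convention (Ξ ⟪ B₀ ⟫) → Pollinatable Π Ξ →
    ∀ {w e} → ⊩B w e (Ξ ⟪ Π ⟫) ⇔ ⊩B w e (Ξ ⟪ [] ⟫)
  pollinate-all Ξ conv [] = ⇔-refl
  pollinate-all Ξ conv (pφ ∷ pΠ) = ⇔-trans (pollinate Ξ conv pφ _) (pollinate-all Ξ conv pΠ)

  infix 4 _≈_
  _≈_ : Bouquet → Bouquet → Set ℓ
  Φ ≈ Ψ = ∀ w e → Eval w e → ⊩B w e Φ ⇔ ⊩B w e Ψ

  ≈-sym : ∀ {Φ Ψ} → Φ ≈ Ψ → Ψ ≈ Φ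
  ≈-sym Φ≈Ψ w e ev = ⇔-sym (Φ≈Ψ w e ev)

  poll-sound : ∀ Ξ Π {B₀} → Convention (Ξ ⟪ B₀ ⟫) → Pollinatable Π Ξ → Ξ ⟪ Π ⟫ ≈ Ξ ⟪ [] ⟫
  poll-sound Ξ Π conv pol _ _ _ = pollinate-all Ξ conv pol

  -- Updating on the empty sprinkler is definitionally the identity.
  epis-sound : ∀ Φ → Φ ≈ [ ([] · []) ▷ [ [] · Φ ] ]
  epis-sound Φ w e ev = mk⇔ (λ hΦ → (λ _ w≤w' g evg _ → inj₁ (g , evg , ⊩B-mono Φ w≤w' hΦ)) , tt) elim
    where
      elim : ⊩B w e [ ([] · []) ▷ [ [] · Φ ] ] → ⊩B w e Φ
      elim (h , _) with h w ≤-refl e ev tt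
      ... | inj₁ (_ , _ , hΦ) = hΦ

  epet-sound : ∀ γ Δ → [ γ ▷ (([] · []) ∷ Δ) ] ≈ []
  epet-sound (_ · _) Δ _ _ _ = mk⇔ (λ _ → tt) (λ _ → (λ _ _ g evg _ → inj₁ (g , evg , tt)) , tt)

  srep-split : ∀ {w e} x Φ γs Δ → (∀ {y Ψ} → (y · Ψ) ∈ γs → Disjoint y (x ++ fvPetals x Δ)) →
    ⊩F w e ((x · (Φ ++ [ ([] · []) ▷ γs ])) ▷ Δ) → ⊩F w e ((x · Φ) ▷ [ [] · map (_▷ Δ) γs ])
  srep-split {e = e} x Φ γs Δ fresh h w' w≤w' g evg hΦ = inj₁ (g , evg , ⊩B-map⁺ γs each)
    where
      each : ∀ {γ} → γ ∈ γs → ⊩F w' (e [ x ↦ g ]) (γ ▷ Δ)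
      each {y · Ψ} γ∈ w'' w'≤w'' g' evg' hΨ =
        to (⊩Petal-coincide x Δ (AgreeOn-fresh-update {ρ = e [ x ↦ g ]} {g'} (fresh γ∈)))
           (h w'' (≤-trans w≤w' w'≤w'') g (Eval-mono w'≤w'' evg) (⊩B-++⁺ Φ (⊩B-mono Φ w'≤w'' hΦ) (hP , tt)))
        where
          hP : ⊩F w'' (e [ x ↦ g ]) (([] · []) ▷ γs)
          hP _ w''≤w₃ _ _ _ = ⊩Petal-∈⁺ γ∈ (g' , Eval-mono w''≤w₃ evg' , ⊩B-mono Ψ w''≤w₃ hΨ)

  srep-merge : ∀ {w e} x Φ γs Δ → (∀ {y Ψ} → (y · Ψ) ∈ γs → Disjoint y (x ++ fvPetals x Δ)) →
    ⊩F w e ((x · Φ) ▷ [ [] · map (_▷ Δ) γs ]) → ⊩F w e ((x · (Φ ++ [ ([] · []) ▷ γs ])) ▷ Δ)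
  srep-merge {e = e} x Φ γs Δ fresh h w' w≤w' g evg hΦP with ⊩B-++⁻ Φ hΦP
  ... | hΦ , hP , _ with ⊩Petal-∈⁻ γs (hP w' ≤-refl g evg tt) | h w' w≤w' g evg hΦ
  ... | y · Ψ , γ∈ , g' , evg' , hΨ | inj₁ (_ , _ , hγs▷Δ) =
    from (⊩Petal-coincide x Δ (AgreeOn-fresh-update {ρ = e [ x ↦ g ]} {g'} (fresh γ∈)))
         (⊩B-∈ (∈-map⁺ (_▷ Δ) γ∈) hγs▷Δ w' ≤-refl g' evg' hΨ)

  srep-sound : ∀ x Φ γs Δ → Convention [ (x · (Φ ++ [ ([] · []) ▷ γs ])) ▷ Δ ] →
    [ (x · (Φ ++ [ ([] · []) ▷ γs ])) ▷ Δ ] ≈ [ (x · Φ) ▷ [ [] · map (_▷ Δ) γs ] ]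
  srep-sound x Φ γs Δ conv _ _ _ =
    mk⇔ (map₁ (srep-split x Φ γs Δ fresh)) (map₁ (srep-merge x Φ γs Δ fresh))
    where
      fresh : ∀ {y Ψ} → (y · Ψ) ∈ γs → Disjoint y (x ++ fvPetals x Δ)
      fresh = srep-fresh x Φ γs Δ conv

  ipis-sound : ∀ x y Φ Δ σ → HasSupport σ y → CaptureAvoiding σ y [ ([] · Φ) ▷ Δ ] →
    [ ((x ++ y) · Φ) ▷ Δ ] ≈ ((x · subB σ Φ) ▷ subGs σ Δ) ∷ [ ((x ++ y) · Φ) ▷ Δ ]
  ipis-sound x y Φ Δ σ supp avoids w e ev = mk⇔ (λ h → instantiate (proj₁ h) , h) proj₂
    where
      nc : NoCaptureIn σ (bvB [ ([] · Φ) ▷ Δ ])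
      nc = captureAvoiding⇒noCapture [ ([] · Φ) ▷ Δ ] supp avoids
      instantiate : ⊩F w e (((x ++ y) · Φ) ▷ Δ) → ⊩F w e ((x · subB σ Φ) ▷ subGs σ Δ)
      instantiate h w' w≤w' g evg hσΦ =
        from (⊩Petal-instance x Δ supp (noCapture-⊆ (∈-++⁺ˡ ∘ ∈-++⁺ʳ (bvB Φ)) nc))
          (h w' w≤w' _ (Eval-update x (Eval-mono w≤w' ev) evg ∘ σ)
            (to (⊩B-instance x Φ supp (noCapture-⊆ (∈-++⁺ˡ ∘ ∈-++⁺ˡ) nc)) hσΦ))

  ipet-sound : ∀ γ x y Φ Δ σ → HasSupport σ y → CaptureAvoiding σ y Φ →
    [ γ ▷ (((x ++ y) · Φ) ∷ Δ) ] ≈ [ γ ▷ ((x · subB σ Φ) ∷ ((x ++ y) · Φ) ∷ Δ) ]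
  ipet-sound (z · Γ) x y Φ Δ σ supp avoids w e ev = mk⇔
    (λ (h , _) → (λ w' w≤w' g evg hΓ → inj₂ (h w' w≤w' g evg hΓ)) , tt)
    (λ (h , _) → (λ w' w≤w' g evg hΓ →
       [ inj₁ ∘ ⊩G-instance x Φ supp nc (Eval-update z (Eval-mono w≤w' ev) evg) , id ]′
         (h w' w≤w' g evg hΓ)) , tt)
    where
      nc : NoCaptureIn σ (bvB Φ)
      nc = captureAvoiding⇒noCapture Φ supp avoids

  shallowStep-sound : ∀ {Φ Ψ} → ShallowStep Φ Ψ → Convention Φ → Φ ≈ Ψ
  shallowStep-sound (poll↓ Ξ Π pol) conv = poll-sound Ξ Π conv pol
  shallowStep-sound (poll↑ Ξ Π pol) conv = ≈-sym (poll-sound Ξ Π conv pol)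
  shallowStep-sound (epis Φ) _ = epis-sound Φ
  shallowStep-sound (epet γ Δ) _ = epet-sound γ Δ
  shallowStep-sound (srep x Φ γs Δ) conv = srep-sound x Φ γs Δ conv
  shallowStep-sound (ipis x y Φ Δ σ supp avoids) _ = ipis-sound x y Φ Δ σ supp avoids
  shallowStep-sound (ipet γ x y Φ Δ σ supp avoids) _ = ipet-sound γ x y Φ Δ σ supp avoids

mainTheorem10 : (S : Signature) (Φ Ψ : Syntax.Bouquet S) →
    Syntax.ShallowStep S Φ Ψ → Syntax.Convention S Φ →
    Syntax._≡ₛ_ S Φ Ψ
mainTheorem10 S Φ Ψ step conv = record
  { to = λ K w e ev → to (Forcing.shallowStep-sound S K step conv w e ev)
  ; from = λ K w e ev → from (Forcing.shallowStep-sound S K step conv w e ev)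
  }
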